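{- Let $M$ be a matroid on a finite set $E$ with closure operator $cl$, let $X\subseteq E$, $e\in X$, and $A\subseteq E$. If $e\in cl(A)$, then $\mathcal T(A)\subseteq cl(A)$.
   Context: An OX-circuit of $M$ is a circuit of $M$ containing an odd number of elements of $X$. For $A\subseteq E$, $\mathcal T(A)=\{x\in E\setminus A : x\neq e$ and there is an OX-circuit $C$ of $M$ with $x,e\in C$ and $C\subseteq A\cup\{e,x\}\}$. -}

module Defs where

open import Data.Nat using (ℕ; _%_)
open import Data.Fin using (Fin)
open import Data.Fin.Subset using (Subset; _∈_; _∉_; _⊆_; _∩_; _∪_; _-_; ⁅_⁆; ∣_∣; Nonempty)
open import Data.Product using (Σ; _×_; ∃)
open import Data.Sum using (_⊎_)
open import Relation.Binary.PropositionalEquality using (_≡_; _≢_)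
open import Level using (Level; suc; _⊔_)

record Matroid (n : ℕ) : Set₁ where
  field
    Circuit : Subset n → Set
    circuit-nonempty : ∀ C → Circuit C → Nonempty C
    circuit-incomparable : ∀ C₁ C₂ → Circuit C₁ → Circuit C₂ → C₁ ⊆ C₂ → C₁ ≡ C₂
    circuit-elim : ∀ C₁ C₂ e → Circuit C₁ → Circuit C₂ → C₁ ≢ C₂ →
                   e ∈ C₁ → e ∈ C₂ →
                   Σ (Subset n) λ C₃ → Circuit C₃ × C₃ ⊆ ((C₁ ∪ C₂) - e)

open Matroid public

module _ {n : ℕ} (M : Matroid n) where

  cl : Subset n → Fin n → Set
  cl A x = x ∈ A ⊎ Σ (Subset n) λ C → Circuit M C × x ∈ C × C ⊆ (A ∪ ⁅ x ⁆)

  OXCircuit : Subset n → Subset n → Set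
  OXCircuit X C = Circuit M C × ∣ C ∩ X ∣ % 2 ≡ 1

  𝒯 : Subset n → Fin n → Subset n → Fin n → Set
  𝒯 X e A x = x ∉ A × x ≢ e ×
    Σ (Subset n) λ C → OXCircuit X C × x ∈ C × e ∈ C × C ⊆ (A ∪ (⁅ e ⁆ ∪ ⁅ x ⁆))

-- If e ∈ A, the circuit C witnessing x ∈ 𝒯(A) already lies in A ∪ {x}.
-- Otherwise some circuit D satisfies e ∈ D ⊆ A ∪ {e}, and x ∉ D; strong
-- circuit elimination of e between C and D, keeping x, gives a circuit
-- through x inside (C ∪ D) - e ⊆ A ∪ {x}.

module Submission where

open import Defs
open import Data.Nat using (ℕ; _<_)
open import Data.Nat.Induction using (<-wellFounded)
open import Data.Fin using (Fin)
open import Data.Fin.Subset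
  using (Subset; _∈_; _∉_; _⊆_; _⊈_; _∪_; _─_; _-_; ⁅_⁆; ∣_∣; inside)
open import Data.Fin.Subset.Properties
open import Data.Fin.Properties using (¬∀⟶∃¬)
open import Data.Vec.Base using (_∷_; here; there)
open import Data.Product using (Σ; ∃; _×_; _,_)
open import Data.Sum using (inj₁; inj₂; [_,_])
open import Function using (_∘_; id)
open import Induction.WellFounded using (Acc; acc)
open import Relation.Nullary using (yes; no; contradiction)
open import Relation.Nullary.Decidable using (_→-dec_)
open import Relation.Binary.PropositionalEquality
  using (_≡_; _≢_; sym; cong; subst; module ≡-Reasoning)

private
  variable
    n : ℕ
    p q r : Subset n
    x y : Fin n

x∈p─q⇒x∉q : x ∈ p ─ q → x ∉ q
x∈p─q⇒x∉q {p = _ ∷ p} {q = _ ∷ q} (there x∈p─q) (there x∈q) = x∈p─q⇒x∉q x∈p─q x∈q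
x∈p─q⇒x∉q {p = _ ∷ p} {q = inside ∷ q} () here

x∉p-x : x ∉ p - x
x∉p-x {x = x} x∈p-x = x∈p─q⇒x∉q x∈p-x (x∈⁅x⁆ x)

p-x⊆p : ∀ (p : Subset n) x → p - x ⊆ p
p-x⊆p p x = p─q⊆p p ⁅ x ⁆

p⊆q⇒p-x⊆q-x : p ⊆ q → p - x ⊆ q - x
p⊆q⇒p-x⊆q-x {p = p} {x = x} p⊆q y∈p-x =
  x∈p∧x≢y⇒x∈p-y (p⊆q (p-x⊆p p x y∈p-x)) (x∉⁅y⁆⇒x≢y (x∈p─q⇒x∉q y∈p-x))

p∪⁅x⁆-x⊆p : (p ∪ ⁅ x ⁆) - x ⊆ p
p∪⁅x⁆-x⊆p {p = p} {x = x} y∈ with x∈p∪q⁻ p ⁅ x ⁆ (p-x⊆p (p ∪ ⁅ x ⁆) x y∈)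
... | inj₁ y∈p  = y∈p
... | inj₂ y∈⁅x⁆ = contradiction y∈⁅x⁆ (x∈p─q⇒x∉q y∈)

x∈p⇒p∪⁅x⁆⊆p : x ∈ p → p ∪ ⁅ x ⁆ ⊆ p
x∈p⇒p∪⁅x⁆⊆p {x = x} {p = p} x∈p y∈ with x∈p∪q⁻ p ⁅ x ⁆ y∈
... | inj₁ y∈p   = y∈p
... | inj₂ y∈⁅x⁆ = subst (_∈ p) (sym (x∈⁅y⁆⇒x≡y x y∈⁅x⁆)) x∈p

x∉p∧x≢y⇒x∉p∪⁅y⁆ : x ∉ p → x ≢ y → x ∉ p ∪ ⁅ y ⁆
x∉p∧x≢y⇒x∉p∪⁅y⁆ {p = p} {y = y} x∉p x≢y =
  [ x∉p , x≢y⇒x∉⁅y⁆ x≢y ] ∘ x∈p∪q⁻ p ⁅ y ⁆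

x∈p∪q∧x∉p⇒x∈q : x ∈ p ∪ q → x ∉ p → x ∈ q
x∈p∪q∧x∉p⇒x∈q {p = p} {q = q} x∈p∪q x∉p =
  [ (λ x∈p → contradiction x∈p x∉p) , id ] (x∈p∪q⁻ p q x∈p∪q)

p⊆r∧q⊆r⇒p∪q⊆r : p ⊆ r → q ⊆ r → p ∪ q ⊆ r
p⊆r∧q⊆r⇒p∪q⊆r {p = p} {q = q} p⊆r q⊆r = [ p⊆r , q⊆r ] ∘ x∈p∪q⁻ p q

p∪[q∪r]≡[p∪r]∪q : ∀ (p q r : Subset n) → p ∪ (q ∪ r) ≡ (p ∪ r) ∪ q
p∪[q∪r]≡[p∪r]∪q p q r = begin
  p ∪ (q ∪ r) ≡⟨ cong (p ∪_) (∪-comm q r) ⟩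
  p ∪ (r ∪ q) ≡⟨ sym (∪-assoc p r q) ⟩
  (p ∪ r) ∪ q ∎
  where open ≡-Reasoning

p⊈q⇒∃x∈p∧x∉q : p ⊈ q → ∃ λ x → x ∈ p × x ∉ q
p⊈q⇒∃x∈p∧x∉q {n} {p} {q} p⊈q
  with ¬∀⟶∃¬ n (λ x → x ∈ p → x ∈ q) (λ x → x ∈? p →-dec x ∈? q) (λ p⊆q → p⊈q (p⊆q _))
... | x , x∈p⇏x∈q with x ∈? p
...   | yes x∈p = x , x∈p , λ x∈q → x∈p⇏x∈q (λ _ → x∈q)
...   | no  x∉p = contradiction (λ x∈p → contradiction x∈p x∉p) x∈p⇏x∈q

module _ (M : Matroid n) where

  CircuitThrough : Fin n → Subset n → Set
  CircuitThrough x S = Σ (Subset n) λ C → Circuit M C × x ∈ C × C ⊆ S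

  CircuitThrough-mono : ∀ {S T} → S ⊆ T → CircuitThrough x S → CircuitThrough x T
  CircuitThrough-mono S⊆T (C , c , x∈C , C⊆S) = C , c , x∈C , S⊆T ∘ C⊆S

  circuit-⊈ : ∀ {C D} → Circuit M C → Circuit M D → x ∈ D → x ∉ C → C ⊈ D
  circuit-⊈ {x = x} {C} {D} c d x∈D x∉C C⊆D =
    x∉C (subst (x ∈_) (sym (circuit-incomparable M C D c d C⊆D)) x∈D)

  -- Oxley, Proposition 1.4.12.  If the circuit C₃ given by (C3) misses f, it
  -- meets C₂ ∖ C₁ in some g (else C₃ ⊊ C₁); eliminate g between C₂ and C₃
  -- keeping e, then e between C₁ and the result keeping f.  The two unions
  -- miss f and g respectively, so induction on ∣ C₁ ∪ C₂ ∣ applies.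
  strong-circuit-elim : ∀ {C₁ C₂ e f} → Circuit M C₁ → Circuit M C₂ →
    e ∈ C₁ → e ∈ C₂ → f ∈ C₁ → f ∉ C₂ → CircuitThrough f ((C₁ ∪ C₂) - e)
  strong-circuit-elim = go (<-wellFounded _)
    where
    go : ∀ {C₁ C₂ e f} → Acc _<_ ∣ C₁ ∪ C₂ ∣ → Circuit M C₁ → Circuit M C₂ →
      e ∈ C₁ → e ∈ C₂ → f ∈ C₁ → f ∉ C₂ → CircuitThrough f ((C₁ ∪ C₂) - e)
    go {C₁} {C₂} {e} {f} (acc rec) c₁ c₂ e∈C₁ e∈C₂ f∈C₁ f∉C₂
      with circuit-elim M C₁ C₂ e c₁ c₂ (λ C₁≡C₂ → f∉C₂ (subst (f ∈_) C₁≡C₂ f∈C₁)) e∈C₁ e∈C₂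
    ... | C₃ , c₃ , C₃⊆ with f ∈? C₃
    ...   | yes f∈C₃ = C₃ , c₃ , f∈C₃ , C₃⊆
    ...   | no  f∉C₃ with p⊈q⇒∃x∈p∧x∉q (circuit-⊈ c₃ c₁ e∈C₁ (x∉p-x ∘ C₃⊆))
    ...     | g , g∈C₃ , g∉C₁ =
      eliminate-e (go (rec ∣C₂∪C₃∣<∣C₁∪C₂∣) c₂ c₃ g∈C₂ g∈C₃ e∈C₂ (x∉p-x ∘ C₃⊆))
      where
      C₃⊆C₁∪C₂ : C₃ ⊆ C₁ ∪ C₂
      C₃⊆C₁∪C₂ = p-x⊆p (C₁ ∪ C₂) e ∘ C₃⊆
      f∉C₂∪C₃ : f ∉ C₂ ∪ C₃
      f∉C₂∪C₃ = [ f∉C₂ , f∉C₃ ] ∘ x∈p∪q⁻ C₂ C₃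
      C₂∪C₃⊆C₁∪C₂ : C₂ ∪ C₃ ⊆ C₁ ∪ C₂
      C₂∪C₃⊆C₁∪C₂ = p⊆r∧q⊆r⇒p∪q⊆r (q⊆p∪q C₁ C₂) C₃⊆C₁∪C₂
      g∈C₂ : g ∈ C₂
      g∈C₂ = x∈p∪q∧x∉p⇒x∈q (C₃⊆C₁∪C₂ g∈C₃) g∉C₁
      ∣C₂∪C₃∣<∣C₁∪C₂∣ : ∣ C₂ ∪ C₃ ∣ < ∣ C₁ ∪ C₂ ∣
      ∣C₂∪C₃∣<∣C₁∪C₂∣ = p⊂q⇒∣p∣<∣q∣ (C₂∪C₃⊆C₁∪C₂ , f , p⊆p∪q C₂ f∈C₁ , f∉C₂∪C₃)
      eliminate-e : CircuitThrough e ((C₂ ∪ C₃) - g) → CircuitThrough f ((C₁ ∪ C₂) - e)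
      eliminate-e (C₄ , c₄ , e∈C₄ , C₄⊆) =
        CircuitThrough-mono (p⊆q⇒p-x⊆q-x C₁∪C₄⊆C₁∪C₂)
          (go (rec ∣C₁∪C₄∣<∣C₁∪C₂∣) c₁ c₄ e∈C₁ e∈C₄ f∈C₁ (f∉C₂∪C₃ ∘ p-x⊆p (C₂ ∪ C₃) g ∘ C₄⊆))
        where
        C₁∪C₄⊆C₁∪C₂ : C₁ ∪ C₄ ⊆ C₁ ∪ C₂
        C₁∪C₄⊆C₁∪C₂ = p⊆r∧q⊆r⇒p∪q⊆r (p⊆p∪q C₂) (C₂∪C₃⊆C₁∪C₂ ∘ p-x⊆p (C₂ ∪ C₃) g ∘ C₄⊆)
        ∣C₁∪C₄∣<∣C₁∪C₂∣ : ∣ C₁ ∪ C₄ ∣ < ∣ C₁ ∪ C₂ ∣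
        ∣C₁∪C₄∣<∣C₁∪C₂∣ = p⊂q⇒∣p∣<∣q∣
          (C₁∪C₄⊆C₁∪C₂ , g , q⊆p∪q C₁ C₂ g∈C₂ , [ g∉C₁ , x∉p-x ∘ C₄⊆ ] ∘ x∈p∪q⁻ C₁ C₄)

  circuit-through-cl⇒cl : ∀ {A C e x} → cl M A e → x ∉ A ∪ ⁅ e ⁆ →
    Circuit M C → x ∈ C → e ∈ C → C ⊆ (A ∪ ⁅ x ⁆) ∪ ⁅ e ⁆ → cl M A x
  circuit-through-cl⇒cl {A} {C} {e} {x} (inj₁ e∈A) _ c x∈C _ C⊆ =
    inj₂ (C , c , x∈C , x∈p⇒p∪⁅x⁆⊆p (p⊆p∪q ⁅ x ⁆ e∈A) ∘ C⊆)
  circuit-through-cl⇒cl {A} {C} {e} {x} (inj₂ (D , d , e∈D , D⊆)) x∉A∪⁅e⁆ c x∈C e∈C C⊆ =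
    inj₂ (CircuitThrough-mono (p∪⁅x⁆-x⊆p ∘ p⊆q⇒p-x⊆q-x C∪D⊆[A∪⁅x⁆]∪⁅e⁆)
           (strong-circuit-elim c d e∈C e∈D x∈C (x∉A∪⁅e⁆ ∘ D⊆)))
    where
    C∪D⊆[A∪⁅x⁆]∪⁅e⁆ : C ∪ D ⊆ (A ∪ ⁅ x ⁆) ∪ ⁅ e ⁆
    C∪D⊆[A∪⁅x⁆]∪⁅e⁆ = p⊆r∧q⊆r⇒p∪q⊆r C⊆
      (p⊆r∧q⊆r⇒p∪q⊆r (p⊆p∪q ⁅ e ⁆ ∘ p⊆p∪q ⁅ x ⁆) (q⊆p∪q (A ∪ ⁅ x ⁆) ⁅ e ⁆) ∘ D⊆)

proposition2p7 : ∀ {n : ℕ} (M : Matroid n) (X : Subset n) (e : Fin n) (A : Subset n) →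
    e ∈ X → cl M A e →
    ∀ (x : Fin n) → 𝒯 M X e A x → cl M A x
proposition2p7 M X e A _ e∈clA x (x∉A , x≢e , C , (c , _) , x∈C , e∈C , C⊆) =
  circuit-through-cl⇒cl M e∈clA (x∉p∧x≢y⇒x∉p∪⁅y⁆ x∉A x≢e) c x∈C e∈C
    (subst (C ⊆_) (p∪[q∪r]≡[p∪r]∪q A ⁅ e ⁆ ⁅ x ⁆) C⊆)
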